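{- For every $\lambda>0$ there exists $\varepsilon=\varepsilon(\lambda)>0$ such that every oriented graph $\vec G=(V,\vec E)$ on $n\ge n_0(\lambda,\varepsilon)$ vertices with $\delta_0(\vec G)\ge(\tfrac13-\varepsilon)n$ is $\lambda$-extremal, provided that either (1) there is a partition $V=V_0\cup V_1\cup V_2$ with $|V_1|,|V_2|\ge(\tfrac13-\varepsilon)n$ and $e_{\vec G}(V_1),\,e_{\vec G}(V_2),\,e_{\vec G}(V_2,V_1)\le\varepsilon n^2$; or (2) $\vec G$ contains no transitive triangle.
   Context: An oriented graph is a loopless directed graph without multiple arcs such that $(u,v)\in\vec E$ forbids $(v,u)\in\vec E$. $\delta_0(\vec G)=\min\{\delta^+(\vec G),\delta^-(\vec G)\}$. For $A,B\subseteq V$, $e_{\vec G}(A,B)=|\vec E\cap(A\times B)|$ and $e_{\vec G}(A)$ is the number of arcs with both ends in $A$. A transitive triangle is a set of three arcs $(x,y),(x,z),(y,z)$. An $n$-vertex directed graph is $\lambda$-extremal if there is a partition $V=W_0\cup W_1\cup W_2$ with $e_{\vec G}(W_i,W_{i+1})\ge(\tfrac19-\lambda)n^2$ for every $i\in\mathbb Z_3$. $n_0(\lambda,\varepsilon)$ denotes a sufficiently large integer.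
   Formalization: The parameter λ ranges over the positive rationals, and the constant ε is taken in the rationals. -}

module Defs where

open import Data.Nat using (ℕ; zero; suc; _+_)
open import Data.Fin using (Fin; zero; suc)
open import Data.Bool using (Bool; true; false; if_then_else_; _∧_)
open import Data.Integer using (+_)
open import Data.Rational using (ℚ; _/_; _*_; _-_; _≤_)
open import Data.Product using (Σ; ∃; _×_)
open import Relation.Binary.PropositionalEquality using (_≡_)

Σℕ : ∀ {n} → (Fin n → ℕ) → ℕ
Σℕ {zero}  f = 0
Σℕ {suc n} f = f zero + Σℕ (λ i → f (suc i))

count : ∀ {n} → (Fin n → Bool) → ℕ
count P = Σℕ (λ i → if P i then 1 else 0)

record Digraph (n : ℕ) : Set where
  field
    arc : Fin n → Fin n → Bool

open Digraph public

IsOriented : ∀ {n} → Digraph n → Set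
IsOriented {n} G =
  ((v : Fin n) → arc G v v ≡ false) ×
  ((u v : Fin n) → arc G u v ≡ true → arc G v u ≡ false)

outdeg : ∀ {n} → Digraph n → Fin n → ℕ
outdeg G u = count (λ v → arc G u v)

indeg : ∀ {n} → Digraph n → Fin n → ℕ
indeg G v = count (λ u → arc G u v)

eAB : ∀ {n} → Digraph n → (Fin n → Bool) → (Fin n → Bool) → ℕ
eAB G A B = Σℕ (λ u → count (λ v → A u ∧ B v ∧ arc G u v))

eIn : ∀ {n} → Digraph n → (Fin n → Bool) → ℕ
eIn G A = eAB G A A

ℕtoℚ : ℕ → ℚ
ℕtoℚ m = + m / 1

part : ∀ {n} → (Fin n → Fin 3) → Fin 3 → (Fin n → Bool)
part p i v with p v | i
... | zero          | zero          = true
... | suc zero      | suc zero      = true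
... | suc (suc zero) | suc (suc zero) = true
... | _             | _             = false

next : Fin 3 → Fin 3
next zero = suc zero
next (suc zero) = suc (suc zero)
next (suc (suc zero)) = zero

MinSemiDegreeAtLeast : ∀ {n} → Digraph n → ℚ → Set
MinSemiDegreeAtLeast {n} G x =
  (v : Fin n) → (x ≤ ℕtoℚ (outdeg G v)) × (x ≤ ℕtoℚ (indeg G v))

IsExtremal : ∀ {n} → ℚ → Digraph n → Set
IsExtremal {n} lam G =
  Σ (Fin n → Fin 3) λ w →
    (i : Fin 3) →
      ((+ 1 / 9) - lam) * ℕtoℚ (n Data.Nat.* n) ≤ ℕtoℚ (eAB G (part w i) (part w (next i)))

HasTransitiveTriangle : ∀ {n} → Digraph n → Set
HasTransitiveTriangle {n} G =
  Σ (Fin n) λ x → Σ (Fin n) λ y → Σ (Fin n) λ z →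
    (arc G x y ≡ true) × (arc G x z ≡ true) × (arc G y z ≡ true)

Condition1 : ∀ {n} → ℚ → Digraph n → Set
Condition1 {n} ε G =
  Σ (Fin n → Fin 3) λ p →
    let V₁ = part p (suc zero) ; V₂ = part p (suc (suc zero)) in
    (((+ 1 / 3) - ε) * ℕtoℚ n ≤ ℕtoℚ (count V₁)) ×
    (((+ 1 / 3) - ε) * ℕtoℚ n ≤ ℕtoℚ (count V₂)) ×
    (ℕtoℚ (eIn G V₁) ≤ ε * ℕtoℚ (n Data.Nat.* n)) ×
    (ℕtoℚ (eIn G V₂) ≤ ε * ℕtoℚ (n Data.Nat.* n)) ×
    (ℕtoℚ (eAB G V₂ V₁) ≤ ε * ℕtoℚ (n Data.Nat.* n))

module Submission where

-- Under hypothesis (1), write δ = (1/3 − ε)n and count arcs at the vertices of V₁ and V₂.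
-- The in-degrees of V₁ give δ|V₁| ≤ e(V₀,V₁) + e(V₁) + e(V₂,V₁), hence e(V₀,V₁) ≥ δ² − 2εn²;
-- symmetrically the out-degrees of V₂ bound e(V₂,V₀) from below. Adding the out- and in-degrees
-- of V₁ and using e(V₀,V₁) + e(V₁,V₀) ≤ |V₀||V₁| (the graph is oriented) gives
-- e(V₁,V₂) ≥ |V₁|(2δ − |V₀|) − 3εn², where |V₀| ≤ n − 2δ. Once ε ≤ 1/12 all three bounds are
-- at least (1/9 − 5ε)n², so ε = min(λ/5, 1/12) works.
-- Hypothesis (2) reduces to (1): for any vertex v let V₁ and V₂ be its out- and in-neighbourhoods.
-- An arc inside V₁, inside V₂, or from V₂ to V₁ would close a transitive triangle with v, and the
-- semidegree bound at v gives |V₁|, |V₂| ≥ δ. Beyond the existence of v, n needs no lower bound.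

open import Defs

module EdgeCounting where
  open import Data.Nat
  open import Data.Nat.Properties using (+-*-semiring; *-identityˡ; +-mono-≤; ≤-refl; module ≤-Reasoning)
  open import Data.Nat.Solver using (module +-*-Solver)
  open +-*-Solver using (solve; _:=_; _:+_; _:*_)
  open import Algebra.Properties.Semiring.Sum +-*-semiring using (sum; ∑-distrib-+; ∑-comm)
  open import Data.Bool using (Bool; true; false; if_then_else_; _∧_)
  open import Data.Empty using (⊥; ⊥-elim)
  open import Data.Fin using (Fin; zero; suc)
  open import Data.Fin.Patterns using (0F; 1F; 2F)
  open import Data.Product using (_,_)
  open import Function using (_∘_)
  open import Relation.Binary.PropositionalEquality
  open import Relation.Nullary using (contradiction)

  Σℕ≡sum : ∀ {n} (f : Fin n → ℕ) → Σℕ f ≡ sum f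
  Σℕ≡sum {zero}  f = refl
  Σℕ≡sum {suc n} f = cong (f zero +_) (Σℕ≡sum (f ∘ suc))

  Σℕ-cong : ∀ {n} {f g : Fin n → ℕ} → (∀ i → f i ≡ g i) → Σℕ f ≡ Σℕ g
  Σℕ-cong {zero}  f≗g = refl
  Σℕ-cong {suc n} f≗g = cong₂ _+_ (f≗g zero) (Σℕ-cong (f≗g ∘ suc))

  Σℕ-mono-≤ : ∀ {n} {f g : Fin n → ℕ} → (∀ i → f i ≤ g i) → Σℕ f ≤ Σℕ g
  Σℕ-mono-≤ {zero}  f≤g = z≤n
  Σℕ-mono-≤ {suc n} f≤g = +-mono-≤ (f≤g zero) (Σℕ-mono-≤ (f≤g ∘ suc))

  Σℕ-zero : ∀ n → Σℕ {n} (λ _ → 0) ≡ 0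
  Σℕ-zero zero    = refl
  Σℕ-zero (suc n) = Σℕ-zero n

  Σℕ-one : ∀ n → Σℕ {n} (λ _ → 1) ≡ n
  Σℕ-one zero    = refl
  Σℕ-one (suc n) = cong suc (Σℕ-one n)

  Σℕ-distrib-+ : ∀ {n} (f g : Fin n → ℕ) → Σℕ (λ i → f i + g i) ≡ Σℕ f + Σℕ g
  Σℕ-distrib-+ f g = begin
    Σℕ (λ i → f i + g i)   ≡⟨ Σℕ≡sum (λ i → f i + g i) ⟩
    sum (λ i → f i + g i)  ≡⟨ ∑-distrib-+ f g ⟩
    sum f + sum g          ≡⟨ cong₂ _+_ (Σℕ≡sum f) (Σℕ≡sum g) ⟨
    Σℕ f + Σℕ g            ∎
    where open ≡-Reasoning

  Σℕ-comm : ∀ {m n} (f : Fin m → Fin n → ℕ) →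
    Σℕ (λ i → Σℕ (λ j → f i j)) ≡ Σℕ (λ j → Σℕ (λ i → f i j))
  Σℕ-comm f = begin
    Σℕ (λ i → Σℕ (λ j → f i j))    ≡⟨ Σℕ²≡sum² f ⟩
    sum (λ i → sum (λ j → f i j))  ≡⟨ ∑-comm f ⟩
    sum (λ j → sum (λ i → f i j))  ≡⟨ Σℕ²≡sum² (λ j i → f i j) ⟨
    Σℕ (λ j → Σℕ (λ i → f i j))    ∎
    where
    open ≡-Reasoning
    Σℕ²≡sum² : ∀ {k l} (g : Fin k → Fin l → ℕ) → Σℕ (λ i → Σℕ (g i)) ≡ sum (λ i → sum (g i))
    Σℕ²≡sum² g = trans (Σℕ-cong (λ i → Σℕ≡sum (g i))) (Σℕ≡sum (λ i → sum (g i)))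

  Σℕ-split₃ : ∀ {n} {f g₁ g₂ g₃ : Fin n → ℕ} → (∀ i → f i ≡ g₁ i + g₂ i + g₃ i) →
    Σℕ f ≡ Σℕ g₁ + Σℕ g₂ + Σℕ g₃
  Σℕ-split₃ {f = f} {g₁} {g₂} {g₃} f≡ = begin
    Σℕ f                                   ≡⟨ Σℕ-cong f≡ ⟩
    Σℕ (λ i → g₁ i + g₂ i + g₃ i)          ≡⟨ Σℕ-distrib-+ _ g₃ ⟩
    Σℕ (λ i → g₁ i + g₂ i) + Σℕ g₃         ≡⟨ cong (_+ Σℕ g₃) (Σℕ-distrib-+ g₁ g₂) ⟩
    Σℕ g₁ + Σℕ g₂ + Σℕ g₃                  ∎
    where open ≡-Reasoning

  ind : Bool → ℕ
  ind b = if b then 1 else 0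

  ind-∧ : ∀ x y → ind (x ∧ y) ≡ ind x * ind y
  ind-∧ true  y = sym (*-identityˡ (ind y))
  ind-∧ false y = refl

  ind-∧₃ : ∀ x y z → ind (x ∧ y ∧ z) ≡ ind x * ind y * ind z
  ind-∧₃ x y z = begin
    ind (x ∧ y ∧ z)         ≡⟨ ind-∧ x (y ∧ z) ⟩
    ind x * ind (y ∧ z)     ≡⟨ cong (ind x *_) (ind-∧ y z) ⟩
    ind x * (ind y * ind z) ≡⟨ solve 3 (λ a b c → a :* (b :* c) := a :* b :* c) refl (ind x) (ind y) (ind z) ⟩
    ind x * ind y * ind z   ∎
    where open ≡-Reasoning

  ind-∧₃≡0 : ∀ x y z → (x ≡ true → y ≡ true → z ≡ true → ⊥) → ind (x ∧ y ∧ z) ≡ 0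
  ind-∧₃≡0 true  true  true  ¬xyz = ⊥-elim (¬xyz refl refl refl)
  ind-∧₃≡0 true  true  false ¬xyz = refl
  ind-∧₃≡0 true  false z     ¬xyz = refl
  ind-∧₃≡0 false y     z     ¬xyz = refl

  ind-∧₃-splitʳ : ∀ x y y₁ y₂ y₃ z → ind y ≡ ind y₁ + ind y₂ + ind y₃ →
    ind (x ∧ y ∧ z) ≡ ind (x ∧ y₁ ∧ z) + ind (x ∧ y₂ ∧ z) + ind (x ∧ y₃ ∧ z)
  ind-∧₃-splitʳ x y y₁ y₂ y₃ z y≡
    rewrite ind-∧₃ x y z | ind-∧₃ x y₁ z | ind-∧₃ x y₂ z | ind-∧₃ x y₃ z | y≡ =
      solve 5 (λ a b₁ b₂ b₃ c → a :* (b₁ :+ b₂ :+ b₃) :* c := a :* b₁ :* c :+ a :* b₂ :* c :+ a :* b₃ :* c)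
        refl (ind x) (ind y₁) (ind y₂) (ind y₃) (ind z)

  ind-∧₃-splitˡ : ∀ x x₁ x₂ x₃ y z → ind x ≡ ind x₁ + ind x₂ + ind x₃ →
    ind (x ∧ y ∧ z) ≡ ind (x₁ ∧ y ∧ z) + ind (x₂ ∧ y ∧ z) + ind (x₃ ∧ y ∧ z)
  ind-∧₃-splitˡ x x₁ x₂ x₃ y z x≡
    rewrite ind-∧₃ x y z | ind-∧₃ x₁ y z | ind-∧₃ x₂ y z | ind-∧₃ x₃ y z | x≡ =
      solve 5 (λ a₁ a₂ a₃ b c → (a₁ :+ a₂ :+ a₃) :* b :* c := a₁ :* b :* c :+ a₂ :* b :* c :+ a₃ :* b :* c)
        refl (ind x₁) (ind x₂) (ind x₃) (ind y) (ind z)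

  Σℕ-ind-∧ : ∀ {n} b (f : Fin n → Bool) → Σℕ (λ v → ind (b ∧ f v)) ≡ (if b then count f else 0)
  Σℕ-ind-∧     true  f = refl
  Σℕ-ind-∧ {n} false f = Σℕ-zero n

  sumOver : ∀ {n} → (Fin n → Bool) → (Fin n → ℕ) → ℕ
  sumOver A f = Σℕ (λ u → if A u then f u else 0)

  sumOver-const : ∀ {n} (A : Fin n → Bool) k → sumOver A (λ _ → k) ≡ count A * k
  sumOver-const {zero}  A k = refl
  sumOver-const {suc n} A k with A zero
  ... | true  = cong (k +_) (sumOver-const (A ∘ suc) k)
  ... | false = sumOver-const (A ∘ suc) k

  allVertices : ∀ {n} → Fin n → Bool
  allVertices _ = true

  part-cover : ∀ {n} (p : Fin n → Fin 3) v → 1 ≡ ind (part p 0F v) + ind (part p 1F v) + ind (part p 2F v)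
  part-cover p v with p v
  ... | 0F = refl
  ... | 1F = refl
  ... | 2F = refl

  count-partition : ∀ {n} (p : Fin n → Fin 3) → count (part p 0F) + count (part p 1F) + count (part p 2F) ≡ n
  count-partition {n} p = trans (sym (Σℕ-split₃ (part-cover p))) (Σℕ-one n)

  module _ {n} (G : Digraph n) where

    eAB-outdeg : ∀ A → eAB G A allVertices ≡ sumOver A (outdeg G)
    eAB-outdeg A = Σℕ-cong λ u → Σℕ-ind-∧ (A u) (arc G u)

    eAB-indeg : ∀ B → eAB G allVertices B ≡ sumOver B (indeg G)
    eAB-indeg B = trans (Σℕ-comm (λ u v → ind (B v ∧ arc G u v)))
                        (Σℕ-cong λ v → Σℕ-ind-∧ (B v) (λ u → arc G u v))

    eAB-partitionʳ : ∀ A (p : Fin n → Fin 3) →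
      eAB G A allVertices ≡ eAB G A (part p 0F) + eAB G A (part p 1F) + eAB G A (part p 2F)
    eAB-partitionʳ A p = Σℕ-split₃ λ u → Σℕ-split₃ λ v →
      ind-∧₃-splitʳ (A u) true (P 0F v) (P 1F v) (P 2F v) (arc G u v) (part-cover p v)
      where P = part p

    eAB-partitionˡ : ∀ (p : Fin n → Fin 3) B →
      eAB G allVertices B ≡ eAB G (part p 0F) B + eAB G (part p 1F) B + eAB G (part p 2F) B
    eAB-partitionˡ p B = Σℕ-split₃ λ u → Σℕ-split₃ λ v →
      ind-∧₃-splitˡ true (P 0F u) (P 1F u) (P 2F u) (B v) (arc G u v) (part-cover p u)
      where P = part p

    eAB≡0 : ∀ {A B} → (∀ u v → A u ≡ true → B v ≡ true → arc G u v ≡ true → ⊥) → eAB G A B ≡ 0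
    eAB≡0 {A} {B} noArc = begin
      eAB G A B                        ≡⟨ Σℕ-cong (λ u → Σℕ-cong (λ v → ind-∧₃≡0 (A u) (B v) (arc G u v) (noArc u v))) ⟩
      Σℕ {n} (λ _ → Σℕ {n} (λ _ → 0))  ≡⟨ Σℕ-cong {n} (λ _ → Σℕ-zero n) ⟩
      Σℕ {n} (λ _ → 0)                 ≡⟨ Σℕ-zero n ⟩
      0                                ∎
      where open ≡-Reasoning

    eAB+eAB-≤-count*count : IsOriented G → ∀ A B → eAB G A B + eAB G B A ≤ count A * count B
    eAB+eAB-≤-count*count (_ , antisym) A B = begin
      eAB G A B + eAB G B A
        ≡⟨ cong (eAB G A B +_) (Σℕ-comm (λ u v → ind (B u ∧ A v ∧ arc G u v))) ⟩
      Σℕ (λ u → Σℕ (λ v → forward u v)) + Σℕ (λ u → Σℕ (λ v → backward u v))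
        ≡⟨ sym (trans (Σℕ-cong (λ u → Σℕ-distrib-+ (forward u) (backward u)))
                      (Σℕ-distrib-+ (λ u → Σℕ (forward u)) (λ u → Σℕ (backward u)))) ⟩
      Σℕ (λ u → Σℕ (λ v → forward u v + backward u v))
        ≤⟨ Σℕ-mono-≤ (λ u → Σℕ-mono-≤ (λ v → at-most-one-direction (A u) (B v) (arc G u v) (arc G v u) (antisym u v))) ⟩
      Σℕ (λ u → Σℕ (λ v → ind (A u ∧ B v)))
        ≡⟨ Σℕ-cong (λ u → Σℕ-ind-∧ (A u) B) ⟩
      sumOver A (λ _ → count B)
        ≡⟨ sumOver-const A (count B) ⟩
      count A * count B ∎
      where
      open ≤-Reasoning
      forward backward : Fin n → Fin n → ℕ
      forward  u v = ind (A u ∧ B v ∧ arc G u v)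
      backward u v = ind (B v ∧ A u ∧ arc G v u)
      at-most-one-direction : ∀ a b c d → (c ≡ true → d ≡ false) → ind (a ∧ b ∧ c) + ind (b ∧ a ∧ d) ≤ ind (a ∧ b)
      at-most-one-direction true  true  true  true  c⇒¬d = contradiction (c⇒¬d refl) λ ()
      at-most-one-direction true  true  true  false _    = ≤-refl
      at-most-one-direction true  true  false true  _    = ≤-refl
      at-most-one-direction true  true  false false _    = z≤n
      at-most-one-direction true  false c     d     _    = z≤n
      at-most-one-direction false true  c     d     _    = z≤n
      at-most-one-direction false false c     d     _    = z≤n

module RationalArithmetic where
  open import Data.Nat as ℕ using (ℕ)
  import Data.Nat.Properties as ℕ
  open import Data.Integer as ℤ using (+_)
  import Data.Integer.Properties as ℤ
  import Data.Integer.Solver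
  open import Data.Rational
  open import Data.Rational.Properties
  import Data.Rational.Solver
  import Data.Rational.Unnormalised as ℚᵘ
  import Data.Rational.Unnormalised.Properties as ℚᵘ
  open import Data.Product using (Σ; _×_; _,_)
  open import Data.Sum using (inj₁; inj₂)
  open import Relation.Binary.PropositionalEquality

  ℕtoℚᵘ : ℕ → ℚᵘ.ℚᵘ
  ℕtoℚᵘ m = ℚᵘ.mkℚᵘ (+ m) 0

  toℚᵘ-ℕtoℚ : ∀ m → toℚᵘ (ℕtoℚ m) ℚᵘ.≃ ℕtoℚᵘ m
  toℚᵘ-ℕtoℚ m = toℚᵘ-fromℚᵘ (ℕtoℚᵘ m)

  ℕtoℚᵘ-+ : ∀ a b → ℕtoℚᵘ (a ℕ.+ b) ℚᵘ.≃ ℕtoℚᵘ a ℚᵘ.+ ℕtoℚᵘ b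
  ℕtoℚᵘ-+ a b = ℚᵘ.*≡* (solve 2 (λ x y →
    (x :+ y) :* (con (+ 1) :* con (+ 1)) := (x :* con (+ 1) :+ y :* con (+ 1)) :* con (+ 1)) refl (+ a) (+ b))
    where open Data.Integer.Solver.+-*-Solver

  ℕtoℚᵘ-* : ∀ a b → ℕtoℚᵘ (a ℕ.* b) ℚᵘ.≃ ℕtoℚᵘ a ℚᵘ.* ℕtoℚᵘ b
  ℕtoℚᵘ-* a b = ℚᵘ.*≡* (cong (ℤ._* + 1) (ℤ.pos-* a b))

  ℕtoℚ-+ : ∀ a b → ℕtoℚ (a ℕ.+ b) ≡ ℕtoℚ a + ℕtoℚ b
  ℕtoℚ-+ a b = toℚᵘ-injective (begin
    toℚᵘ (ℕtoℚ (a ℕ.+ b))           ≈⟨ toℚᵘ-ℕtoℚ (a ℕ.+ b) ⟩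
    ℕtoℚᵘ (a ℕ.+ b)                 ≈⟨ ℕtoℚᵘ-+ a b ⟩
    ℕtoℚᵘ a ℚᵘ.+ ℕtoℚᵘ b            ≈⟨ ℚᵘ.+-cong (toℚᵘ-ℕtoℚ a) (toℚᵘ-ℕtoℚ b) ⟨
    toℚᵘ (ℕtoℚ a) ℚᵘ.+ toℚᵘ (ℕtoℚ b) ≈⟨ toℚᵘ-homo-+ (ℕtoℚ a) (ℕtoℚ b) ⟨
    toℚᵘ (ℕtoℚ a + ℕtoℚ b)          ∎)
    where open ℚᵘ.≃-Reasoning

  ℕtoℚ-* : ∀ a b → ℕtoℚ (a ℕ.* b) ≡ ℕtoℚ a * ℕtoℚ b
  ℕtoℚ-* a b = toℚᵘ-injective (begin
    toℚᵘ (ℕtoℚ (a ℕ.* b))           ≈⟨ toℚᵘ-ℕtoℚ (a ℕ.* b) ⟩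
    ℕtoℚᵘ (a ℕ.* b)                 ≈⟨ ℕtoℚᵘ-* a b ⟩
    ℕtoℚᵘ a ℚᵘ.* ℕtoℚᵘ b            ≈⟨ ℚᵘ.*-cong (toℚᵘ-ℕtoℚ a) (toℚᵘ-ℕtoℚ b) ⟨
    toℚᵘ (ℕtoℚ a) ℚᵘ.* toℚᵘ (ℕtoℚ b) ≈⟨ toℚᵘ-homo-* (ℕtoℚ a) (ℕtoℚ b) ⟨
    toℚᵘ (ℕtoℚ a * ℕtoℚ b)          ∎)
    where open ℚᵘ.≃-Reasoning

  ℕtoℚ-+₃ : ∀ a b c → ℕtoℚ (a ℕ.+ b ℕ.+ c) ≡ ℕtoℚ a + ℕtoℚ b + ℕtoℚ c
  ℕtoℚ-+₃ a b c = trans (ℕtoℚ-+ (a ℕ.+ b) c) (cong (_+ ℕtoℚ c) (ℕtoℚ-+ a b))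

  0≤ℕtoℚ : ∀ m → 0ℚ ≤ ℕtoℚ m
  0≤ℕtoℚ m = nonNegative⁻¹ (ℕtoℚ m) {{normalize-nonNeg m 1}}

  ℕtoℚ-mono-≤ : ∀ {a b} → a ℕ.≤ b → ℕtoℚ a ≤ ℕtoℚ b
  ℕtoℚ-mono-≤ {a} a≤b with ℕ.m≤n⇒∃[o]m+o≡n a≤b
  ... | k , refl = subst₂ _≤_ (+-identityʳ (ℕtoℚ a)) (sym (ℕtoℚ-+ a k))
                          (+-monoʳ-≤ (ℕtoℚ a) (0≤ℕtoℚ k))

  0≤+ : ∀ {p q} → 0ℚ ≤ p → 0ℚ ≤ q → 0ℚ ≤ p + q
  0≤+ = +-mono-≤

  0≤* : ∀ {p q} → 0ℚ ≤ p → 0ℚ ≤ q → 0ℚ ≤ p * q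
  0≤* {p} {q} 0≤p 0≤q = nonNegative⁻¹ (p * q) {{nonNeg*nonNeg⇒nonNeg p {{nonNegative 0≤p}} q {{nonNegative 0≤q}}}}

  p≤q⇒0≤q-p : ∀ {p q} → p ≤ q → 0ℚ ≤ q - p
  p≤q⇒0≤q-p {p} {q} p≤q = subst (_≤ q - p) (+-inverseʳ p) (+-monoˡ-≤ (- p) p≤q)

  ≤-by-gap : ∀ {p q} d → q ≡ p + d → 0ℚ ≤ d → p ≤ q
  ≤-by-gap {p} d q≡p+d 0≤d = subst₂ _≤_ (+-identityʳ p) (sym q≡p+d) (+-monoʳ-≤ p 0≤d)

  open Data.Rational.Solver.+-*-Solver

  0≤⅓-ε*n : ∀ {ε n} → ε ≤ + 1 / 12 → 0ℚ ≤ n → 0ℚ ≤ (+ 1 / 3 - ε) * n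
  0≤⅓-ε*n {ε} ε≤ 0≤n = 0≤* (≤-by-gap (+ 1 / 12 - ε + + 1 / 4)
    (solve 1 (λ e → con (+ 1 / 3) :- e := con 0ℚ :+ (con (+ 1 / 12) :- e :+ con (+ 1 / 4))) refl ε)
    (0≤+ (p≤q⇒0≤q-p ε≤) (nonNegative⁻¹ _))) 0≤n

  corner-bound : ∀ {ε n N b x y z} → N ≡ n * n → 0ℚ ≤ ε → ε ≤ + 1 / 12 → 0ℚ ≤ n →
    (+ 1 / 3 - ε) * n ≤ b → (+ 1 / 3 - ε) * n * b ≤ x + y + z → y ≤ ε * N → z ≤ ε * N →
    (+ 1 / 9 - + 5 / 1 * ε) * N ≤ x
  corner-bound {ε} {n} {_} {b} {x} {y} {z} refl 0≤ε ε≤ 0≤n δ≤b δb≤ y≤ z≤ =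
    ≤-by-gap gap certificate
      (0≤+ (0≤+ (0≤+ (0≤+ (0≤+
        (p≤q⇒0≤q-p δb≤)
        (0≤* 0≤δ (p≤q⇒0≤q-p δ≤b)))
        (p≤q⇒0≤q-p y≤))
        (p≤q⇒0≤q-p z≤))
        (0≤* (0≤* (nonNegative⁻¹ _) 0≤ε) 0≤N))
        (0≤* (0≤* 0≤ε 0≤ε) 0≤N))
    where
    δ = (+ 1 / 3 - ε) * n
    N = n * n
    0≤δ = 0≤⅓-ε*n ε≤ 0≤n
    0≤N = 0≤* 0≤n 0≤n
    gap = (x + y + z - δ * b) + δ * (b - δ) + (ε * N - y) + (ε * N - z)
          + + 7 / 3 * ε * N + ε * ε * N
    certificate : x ≡ (+ 1 / 9 - + 5 / 1 * ε) * N + gap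
    certificate = solve 6 (λ e n b x y z →
      let δ = (con (+ 1 / 3) :- e) :* n ; N = n :* n in
      x := (con (+ 1 / 9) :- con (+ 5 / 1) :* e) :* N
           :+ ((x :+ y :+ z :- δ :* b) :+ δ :* (b :- δ) :+ (e :* N :- y) :+ (e :* N :- z)
               :+ con (+ 7 / 3) :* e :* N :+ e :* e :* N)) refl ε n b x y z

  middle-bound : ∀ {ε n N a b c e₀₁ e₁₀ e₁₁ e₁₂ e₂₁} → n ≡ a + b + c → N ≡ n * n →
    0ℚ ≤ ε → ε ≤ + 1 / 12 → 0ℚ ≤ n →
    (+ 1 / 3 - ε) * n ≤ b → (+ 1 / 3 - ε) * n ≤ c →
    (+ 1 / 3 - ε) * n * b ≤ e₁₀ + e₁₁ + e₁₂ → (+ 1 / 3 - ε) * n * b ≤ e₀₁ + e₁₁ + e₂₁ →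
    e₀₁ + e₁₀ ≤ a * b → e₁₁ ≤ ε * N → e₂₁ ≤ ε * N →
    (+ 1 / 9 - + 5 / 1 * ε) * N ≤ e₁₂
  middle-bound {ε} {_} {_} {a} {b} {c} {e₀₁} {e₁₀} {e₁₁} {e₁₂} {e₂₁} refl refl 0≤ε ε≤ 0≤n
               δ≤b δ≤c out≥ in≥ e₀₁+e₁₀≤ e₁₁≤ e₂₁≤ =
    ≤-by-gap gap certificate
      (0≤+ (0≤+ (0≤+ (0≤+ (0≤+ (0≤+ (0≤+ (0≤+
        (p≤q⇒0≤q-p out≥)
        (p≤q⇒0≤q-p in≥))
        (p≤q⇒0≤q-p e₀₁+e₁₀≤))
        (0≤* (p≤q⇒0≤q-p e₁₁≤) (nonNegative⁻¹ _)))
        (p≤q⇒0≤q-p e₂₁≤))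
        (0≤* (0≤* (p≤q⇒0≤q-p δ≤b) (0≤* (p≤q⇒0≤q-p ε≤) 0≤n)) (nonNegative⁻¹ _)))
        (0≤* 0≤b (0≤+ (p≤q⇒0≤q-p δ≤b) (p≤q⇒0≤q-p δ≤c))))
        (0≤* (0≤* (nonNegative⁻¹ _) 0≤ε) 0≤N))
        (0≤* (0≤* (0≤* (nonNegative⁻¹ _) 0≤ε) 0≤ε) 0≤N))
    where
    n = a + b + c
    δ = (+ 1 / 3 - ε) * n
    N = n * n
    0≤b = ≤-trans (0≤⅓-ε*n ε≤ 0≤n) δ≤b
    0≤N = 0≤* 0≤n 0≤n
    gap = (e₁₀ + e₁₁ + e₁₂ - δ * b) + (e₀₁ + e₁₁ + e₂₁ - δ * b) + (a * b - (e₀₁ + e₁₀))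
          + (ε * N - e₁₁) * (+ 2 / 1) + (ε * N - e₂₁)
          + (b - δ) * ((+ 1 / 12 - ε) * n) * (+ 4 / 1) + b * ((b - δ) + (c - δ))
          + + 1 / 3 * ε * N + + 4 / 1 * ε * ε * N
    certificate : e₁₂ ≡ (+ 1 / 9 - + 5 / 1 * ε) * N + gap
    certificate = solve 9 (λ e a b c e₀₁ e₁₀ e₁₁ e₁₂ e₂₁ →
      let n = a :+ b :+ c ; δ = (con (+ 1 / 3) :- e) :* n ; N = n :* n in
      e₁₂ := (con (+ 1 / 9) :- con (+ 5 / 1) :* e) :* N
             :+ ((e₁₀ :+ e₁₁ :+ e₁₂ :- δ :* b) :+ (e₀₁ :+ e₁₁ :+ e₂₁ :- δ :* b) :+ (a :* b :- (e₀₁ :+ e₁₀))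
                 :+ (e :* N :- e₁₁) :* con (+ 2 / 1) :+ (e :* N :- e₂₁)
                 :+ (b :- δ) :* ((con (+ 1 / 12) :- e) :* n) :* con (+ 4 / 1) :+ b :* ((b :- δ) :+ (c :- δ))
                 :+ con (+ 1 / 3) :* e :* N :+ con (+ 4 / 1) :* e :* e :* N))
      refl ε a b c e₀₁ e₁₀ e₁₁ e₁₂ e₂₁

  admissible-ε : ∀ {lam} → 0ℚ < lam → Σ ℚ λ ε → 0ℚ < ε × ε ≤ + 1 / 12 × + 5 / 1 * ε ≤ lam
  admissible-ε {lam} 0<lam = ε , 0<ε , p⊓q≤q (lam * (+ 1 / 5)) (+ 1 / 12) , 5ε≤lam
    where
    ε = (lam * (+ 1 / 5)) ⊓ (+ 1 / 12)
    0<ε : 0ℚ < ε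
    0<ε with ⊓-sel (lam * (+ 1 / 5)) (+ 1 / 12)
    ... | inj₁ ε≡ = subst (0ℚ <_) (sym ε≡) (*-monoˡ-<-pos (+ 1 / 5) 0<lam)
    ... | inj₂ ε≡ = subst (0ℚ <_) (sym ε≡) (positive⁻¹ _)
    5ε≤lam : + 5 / 1 * ε ≤ lam
    5ε≤lam = ≤-trans (*-monoˡ-≤-nonNeg (+ 5 / 1) (p⊓q≤p (lam * (+ 1 / 5)) (+ 1 / 12)))
                     (≤-reflexive (solve 1 (λ l → con (+ 5 / 1) :* (l :* con (+ 1 / 5)) := l) refl lam))

module Extremality where
  open import Data.Nat as ℕ using (ℕ; zero; suc)
  open import Data.Bool using (Bool; true; false; if_then_else_)
  open import Data.Fin using (Fin; zero; suc)
  open import Data.Fin.Patterns using (0F; 1F; 2F)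
  open import Data.Integer using (+_)
  open import Data.Product using (_,_; proj₁; proj₂)
  open import Data.Rational
  open import Data.Rational.Properties
  open import Data.Sum using (_⊎_; inj₁; inj₂)
  open import Function using (_∘_)
  open import Relation.Binary.PropositionalEquality
  open import Relation.Nullary using (¬_)
  open EdgeCounting
  open RationalArithmetic

  sumOver-≥ : ∀ {n} (A : Fin n → Bool) (f : Fin n → ℕ) {x} → (∀ u → x ≤ ℕtoℚ (f u)) →
    x * ℕtoℚ (count A) ≤ ℕtoℚ (sumOver A f)
  sumOver-≥ {zero}  A f {x} x≤f = ≤-reflexive (*-zeroʳ x)
  sumOver-≥ {suc n} A f {x} x≤f with A zero
  ... | false = sumOver-≥ (A ∘ suc) (f ∘ suc) (x≤f ∘ suc)
  ... | true  = begin
    x * ℕtoℚ (1 ℕ.+ c)               ≡⟨ cong (x *_) (ℕtoℚ-+ 1 c) ⟩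
    x * (1ℚ + ℕtoℚ c)                ≡⟨ *-distribˡ-+ x 1ℚ (ℕtoℚ c) ⟩
    x * 1ℚ + x * ℕtoℚ c              ≡⟨ cong (_+ x * ℕtoℚ c) (*-identityʳ x) ⟩
    x + x * ℕtoℚ c                   ≤⟨ +-mono-≤ (x≤f zero) (sumOver-≥ (A ∘ suc) (f ∘ suc) (x≤f ∘ suc)) ⟩
    ℕtoℚ (f zero) + ℕtoℚ s           ≡⟨ ℕtoℚ-+ (f zero) s ⟨
    ℕtoℚ (f zero ℕ.+ s)              ∎
    where
    open ≤-Reasoning
    c = count (A ∘ suc)
    s = sumOver (A ∘ suc) (f ∘ suc)

  module _ {n} {G : Digraph n} {δ : ℚ} (deg : MinSemiDegreeAtLeast G δ) where

    out-partition-≥ : ∀ A (p : Fin n → Fin 3) → δ * ℕtoℚ (count A) ≤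
      ℕtoℚ (eAB G A (part p 0F)) + ℕtoℚ (eAB G A (part p 1F)) + ℕtoℚ (eAB G A (part p 2F))
    out-partition-≥ A p = begin
      δ * ℕtoℚ (count A)                  ≤⟨ sumOver-≥ A (outdeg G) (proj₁ ∘ deg) ⟩
      ℕtoℚ (sumOver A (outdeg G))         ≡⟨ cong ℕtoℚ (eAB-outdeg G A) ⟨
      ℕtoℚ (eAB G A allVertices)          ≡⟨ cong ℕtoℚ (eAB-partitionʳ G A p) ⟩
      ℕtoℚ (e 0F ℕ.+ e 1F ℕ.+ e 2F)      ≡⟨ ℕtoℚ-+₃ (e 0F) (e 1F) (e 2F) ⟩
      ℕtoℚ (e 0F) + ℕtoℚ (e 1F) + ℕtoℚ (e 2F) ∎
      where
      open ≤-Reasoning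
      e = λ i → eAB G A (part p i)

    in-partition-≥ : ∀ (p : Fin n → Fin 3) B → δ * ℕtoℚ (count B) ≤
      ℕtoℚ (eAB G (part p 0F) B) + ℕtoℚ (eAB G (part p 1F) B) + ℕtoℚ (eAB G (part p 2F) B)
    in-partition-≥ p B = begin
      δ * ℕtoℚ (count B)                  ≤⟨ sumOver-≥ B (indeg G) (proj₂ ∘ deg) ⟩
      ℕtoℚ (sumOver B (indeg G))          ≡⟨ cong ℕtoℚ (eAB-indeg G B) ⟨
      ℕtoℚ (eAB G allVertices B)          ≡⟨ cong ℕtoℚ (eAB-partitionˡ G p B) ⟩
      ℕtoℚ (e 0F ℕ.+ e 1F ℕ.+ e 2F)      ≡⟨ ℕtoℚ-+₃ (e 0F) (e 1F) (e 2F) ⟩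
      ℕtoℚ (e 0F) + ℕtoℚ (e 1F) + ℕtoℚ (e 2F) ∎
      where
      open ≤-Reasoning
      e = λ i → eAB G (part p i) B

  condition1⇒extremal : ∀ {n ε} {G : Digraph n} → 0ℚ ≤ ε → ε ≤ + 1 / 12 → IsOriented G →
    MinSemiDegreeAtLeast G ((+ 1 / 3 - ε) * ℕtoℚ n) → Condition1 ε G → IsExtremal (+ 5 / 1 * ε) G
  condition1⇒extremal {n} {ε} {G} 0≤ε ε≤ oriented deg (p , δ≤|V₁| , δ≤|V₂| , e₁₁≤ , e₂₂≤ , e₂₁≤) = p , λ where
      0F → corner-bound {b = c 1F} {x = e 0F 1F} N≡n*n 0≤ε ε≤ 0≤n δ≤|V₁| (in-partition-≥ deg p (V 1F)) e₁₁≤ e₂₁≤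
      1F → middle-bound {a = c 0F} {e₀₁ = e 0F 1F} {e₁₀ = e 1F 0F} n≡ N≡n*n 0≤ε ε≤ 0≤n δ≤|V₁| δ≤|V₂|
             (out-partition-≥ deg (V 1F) p) (in-partition-≥ deg p (V 1F)) e₀₁+e₁₀≤ e₁₁≤ e₂₁≤
      2F → corner-bound {b = c 2F} {x = e 2F 0F} N≡n*n 0≤ε ε≤ 0≤n δ≤|V₂| (out-partition-≥ deg (V 2F) p) e₂₁≤ e₂₂≤
    where
    V = part p
    c : Fin 3 → ℚ
    c i = ℕtoℚ (count (V i))
    e : Fin 3 → Fin 3 → ℚ
    e i j = ℕtoℚ (eAB G (V i) (V j))
    0≤n = 0≤ℕtoℚ n
    N≡n*n = ℕtoℚ-* n n
    n≡ : ℕtoℚ n ≡ c 0F + c 1F + c 2F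
    n≡ = trans (cong ℕtoℚ (sym (count-partition p))) (ℕtoℚ-+₃ (count (V 0F)) (count (V 1F)) (count (V 2F)))
    e₀₁+e₁₀≤ : e 0F 1F + e 1F 0F ≤ c 0F * c 1F
    e₀₁+e₁₀≤ = subst₂ _≤_ (ℕtoℚ-+ (eAB G (V 0F) (V 1F)) (eAB G (V 1F) (V 0F)))
                          (ℕtoℚ-* (count (V 0F)) (count (V 1F)))
                          (ℕtoℚ-mono-≤ (eAB+eAB-≤-count*count G oriented (V 0F) (V 1F)))

  neighbourhoodPartition : ∀ {n} → Digraph n → Fin n → Fin n → Fin 3
  neighbourhoodPartition G v₀ u = if arc G v₀ u then 1F else if arc G u v₀ then 2F else 0F

  module _ {n} (G : Digraph n) (v₀ : Fin n) where

    outNeighbourhood : ∀ u → part (neighbourhoodPartition G v₀) 1F u ≡ arc G v₀ u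
    outNeighbourhood u with arc G v₀ u
    ... | true = refl
    ... | false with arc G u v₀
    ...   | true  = refl
    ...   | false = refl

    inNeighbourhood : IsOriented G → ∀ u → part (neighbourhoodPartition G v₀) 2F u ≡ arc G u v₀
    inNeighbourhood (_ , antisym) u with arc G v₀ u in v₀u
    ... | true = sym (antisym v₀ u v₀u)
    ... | false with arc G u v₀
    ...   | true  = refl
    ...   | false = refl

  triangleFree⇒condition1 : ∀ {n ε} {G : Digraph n} → Fin n → 0ℚ ≤ ε → IsOriented G →
    MinSemiDegreeAtLeast G ((+ 1 / 3 - ε) * ℕtoℚ n) → ¬ HasTransitiveTriangle G → Condition1 ε G
  triangleFree⇒condition1 {n} {ε} {G} v₀ 0≤ε oriented deg noTT =
    π , δ≤|V₁| , δ≤|V₂| , negligible e₁₁≡0 , negligible e₂₂≡0 , negligible e₂₁≡0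
    where
    π = neighbourhoodPartition G v₀
    out = outNeighbourhood G v₀
    in′ = inNeighbourhood G v₀ oriented
    δ≤|V₁| = subst (λ k → (+ 1 / 3 - ε) * ℕtoℚ n ≤ ℕtoℚ k) (sym (Σℕ-cong (cong ind ∘ out))) (proj₁ (deg v₀))
    δ≤|V₂| = subst (λ k → (+ 1 / 3 - ε) * ℕtoℚ n ≤ ℕtoℚ k) (sym (Σℕ-cong (cong ind ∘ in′))) (proj₂ (deg v₀))
    e₁₁≡0 : eIn G (part π 1F) ≡ 0
    e₁₁≡0 = eAB≡0 G λ u v v₀u v₀v uv → noTT (v₀ , u , v , trans (sym (out u)) v₀u , trans (sym (out v)) v₀v , uv)
    e₂₂≡0 : eIn G (part π 2F) ≡ 0
    e₂₂≡0 = eAB≡0 G λ u v uv₀ vv₀ uv → noTT (u , v , v₀ , uv , trans (sym (in′ u)) uv₀ , trans (sym (in′ v)) vv₀)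
    e₂₁≡0 : eAB G (part π 2F) (part π 1F) ≡ 0
    e₂₁≡0 = eAB≡0 G λ u v uv₀ v₀v uv → noTT (u , v₀ , v , trans (sym (in′ u)) uv₀ , uv , trans (sym (out v)) v₀v)
    negligible : ∀ {k} → k ≡ 0 → ℕtoℚ k ≤ ε * ℕtoℚ (n ℕ.* n)
    negligible refl = 0≤* 0≤ε (0≤ℕtoℚ (n ℕ.* n))

  either⇒extremal : ∀ {m ε} {G : Digraph (suc m)} → 0ℚ ≤ ε → ε ≤ + 1 / 12 → IsOriented G →
    MinSemiDegreeAtLeast G ((+ 1 / 3 - ε) * ℕtoℚ (suc m)) →
    Condition1 ε G ⊎ ¬ HasTransitiveTriangle G → IsExtremal (+ 5 / 1 * ε) G
  either⇒extremal {G = G} 0≤ε ε≤ oriented deg (inj₁ condition1) =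
    condition1⇒extremal {G = G} 0≤ε ε≤ oriented deg condition1
  either⇒extremal {G = G} 0≤ε ε≤ oriented deg (inj₂ triangleFree) =
    condition1⇒extremal {G = G} 0≤ε ε≤ oriented deg (triangleFree⇒condition1 0F 0≤ε oriented deg triangleFree)

  IsExtremal-mono : ∀ {n lam lam′} {G : Digraph n} → lam ≤ lam′ → IsExtremal lam G → IsExtremal lam′ G
  IsExtremal-mono {n} lam≤lam′ (w , dense) = w , λ i →
    ≤-trans (*-monoʳ-≤-nonNeg (ℕtoℚ (n ℕ.* n)) {{nonNegative (0≤ℕtoℚ (n ℕ.* n))}}
                              (+-monoʳ-≤ (+ 1 / 9) (neg-antimono-≤ lam≤lam′)))
            (dense i)

open import Data.Nat using (ℕ; _≥_; suc)
open import Data.Rational using (ℚ; 0ℚ; _<_; _-_; _/_; _*_)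
open import Data.Rational.Properties using (<⇒≤)
open import Data.Integer using (+_)
open import Data.Product using (Σ; _×_; _,_)
open import Data.Sum using (_⊎_)
open import Relation.Nullary using (¬_)
open Extremality using (IsExtremal-mono; either⇒extremal)
open RationalArithmetic using (admissible-ε)

fact4p5 : (lam : ℚ) → 0ℚ < lam →
    Σ ℚ λ ε → (0ℚ < ε) × Σ ℕ λ n₀ →
    (n : ℕ) → n ≥ n₀ → (G : Digraph n) → IsOriented G →
    MinSemiDegreeAtLeast G (((+ 1 / 3) - ε) * ℕtoℚ n) →
    (Condition1 ε G ⊎ ¬ HasTransitiveTriangle G) →
    IsExtremal lam G
fact4p5 lam 0<lam =
  let ε , 0<ε , ε≤1/12 , 5ε≤lam = admissible-ε 0<lam in
  ε , 0<ε , 1 , λ { (suc m) _ G oriented deg hypothesis →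
    IsExtremal-mono {G = G} 5ε≤lam (either⇒extremal {G = G} (<⇒≤ 0<ε) ε≤1/12 oriented deg hypothesis) }
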